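{- Let $\Delta \ge 1$ be an integer and let $n_\Delta = 2^\Delta - 1$. Let $D_{n_\Delta}$ be the dihedral group of order $2n_\Delta$, presented as $D_{n_\Delta} = \langle w, x \mid w^2 = e,\ wxw^{ -1} = x^{ -1},\ x^{n_\Delta} = e\rangle$. Let $S = \{w x^{2^{k-1}-1} : k = 1, 2, \dots, \Delta\} = \{w, wx^1, wx^3, \dots, wx^{2^{\Delta-1}-1}\}$. Then the Cayley graph $(D_{n_\Delta}, S)$ is an optimal $(\Delta, \Delta+1)$-broadcast network. That is, it has maximum degree $\Delta$, broadcast time at most $\Delta+1$, and order $2^{\Delta+1}-2 = B(\Delta, \Delta+1)$.
   Context: Graphs are simple, undirected and connected. For a group $A$ and a generating set $S \subseteq A$ closed under inverses, the Cayley graph $(A,S)$ has vertex set $A$, and $a,b$ are adjacent iff $as = b$ for some $s \in S$. (Every element of $S$ above is an involution, so $S$ is closed under inverses.) Broadcasting: a message originates at a vertex $u$. In each unit time step, every vertex that already knows the message may call at most one neighbor, and a called neighbor then knows the message. Each call involves exactly two vertices, and each vertex participates in at most one call per time step. The broadcast time $b(u)$ is the minimum number of time steps after which all vertices know the message. The broadcast time of $G$ is $b(G) = \max_{u} b(u)$. $B(\Delta,t)$ denotes the maximum possible order of a graph of maximum degree $\Delta$ and broadcast time at most $t$. A graph of maximum degree $\Delta$ and broadcast time at most $t$ is an optimal $(\Delta,t)$-broadcast network if its order equals $B(\Delta,t)$. -}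

module Defs where

open import Data.Nat using (ℕ; zero; suc; _+_; _*_; _∸_; _^_; _≤_; _<_)
open import Data.Nat.DivMod using (_mod_)
open import Data.Fin using (Fin; toℕ; splitAt; join; _≟_)
open import Data.Fin.Properties using (any?)
open import Data.Bool using (Bool; true; false; not; T)
open import Data.Sum using (_⊎_; inj₁; inj₂)
open import Data.Product using (Σ; _×_; _,_; ∃)
open import Data.Maybe using (Maybe; just; nothing)
open import Data.List using (List; length; filterᵇ; allFin)
open import Data.Empty using (⊥)
open import Relation.Binary.PropositionalEquality using (_≡_)
open import Relation.Nullary.Decidable using (⌊_⌋)

record Graph : Set where
  field
    order : ℕ
    adj   : Fin order → Fin order → Bool

open Graph public

Adj : (G : Graph) → Fin (order G) → Fin (order G) → Set
Adj G u v = T (adj G u v)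

data Reach (G : Graph) : Fin (order G) → Fin (order G) → Set where
  here : ∀ {u} → Reach G u u
  step : ∀ {u v w} → Adj G u v → Reach G v w → Reach G u w

IsGraph : Graph → Set
IsGraph G =
  (∀ u v → adj G u v ≡ adj G v u) ×
  (∀ u → adj G u u ≡ false) ×
  (∀ u v → Reach G u v)

degree : (G : Graph) → Fin (order G) → ℕ
degree G u = length (filterᵇ (adj G u) (allFin (order G)))

MaxDegree : Graph → ℕ → Set
MaxDegree G Δ = (∀ v → degree G v ≤ Δ) × (∃ λ v → degree G v ≡ Δ)

-- Broadcasting.
-- A call schedule: in round i (i = 0,1,2,...), vertex v calls `calls i v`
-- (nothing = v makes no call).

Schedule : Graph → Set
Schedule G = ℕ → Fin (order G) → Maybe (Fin (order G))

Known : (G : Graph) → Fin (order G) → Schedule G → ℕ → Fin (order G) → Set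
Known G u σ zero    v = v ≡ u
Known G u σ (suc i) v =
  Known G u σ i v ⊎ (Σ (Fin (order G)) λ w → Known G u σ i w × σ i w ≡ just v)

-- validity of the first t rounds: only informed vertices call, calls go
-- along edges, and every vertex participates in at most one call per round.
ValidSchedule : (G : Graph) → Fin (order G) → Schedule G → ℕ → Set
ValidSchedule G u σ t =
  ∀ i → i < t → ∀ v w → σ i v ≡ just w →
    Known G u σ i v ×
    Adj G v w ×
    σ i w ≡ nothing ×
    (∀ v′ → σ i v′ ≡ just w → v′ ≡ v) ×
    (∀ v′ → σ i v′ ≡ just v → ⊥)

BroadcastFromWithin : (G : Graph) → Fin (order G) → ℕ → Set
BroadcastFromWithin G u t =
  Σ (Schedule G) λ σ → ValidSchedule G u σ t × (∀ v → Known G u σ t v)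

BroadcastTimeAtMost : Graph → ℕ → Set
BroadcastTimeAtMost G t = ∀ u → BroadcastFromWithin G u t

-- G is an optimal (Δ,t)-broadcast network: max degree Δ, b(G) ≤ t, and its
-- order equals B(Δ,t), i.e. it is maximal among all (simple, connected)
-- graphs of maximum degree Δ and broadcast time at most t.
OptimalBroadcastNetwork : Graph → ℕ → ℕ → Set
OptimalBroadcastNetwork G Δ t =
  IsGraph G × MaxDegree G Δ × BroadcastTimeAtMost G t ×
  (∀ H → IsGraph H → MaxDegree H Δ → BroadcastTimeAtMost H t →
     order H ≤ order G)

-- The dihedral group D_n of order 2n, elements w^b x^i (b : Bool, i : Fin n)
-- encoded as Fin (n + n): join (inj₁ i) = x^i, join (inj₂ i) = w x^i.

subMod : ∀ {n} → ℕ → Fin n → Fin n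
subMod {suc k} m i = (m + suc k ∸ toℕ i) mod (suc k)

-- right multiplication by w x^m :  (w^b x^i)(w x^m) = w^(1-b) x^(m-i)
mulWX : ∀ n → Fin (n + n) → ℕ → Fin (n + n)
mulWX n a m with splitAt n a
... | inj₁ i = join n n (inj₂ (subMod m i))
... | inj₂ i = join n n (inj₁ (subMod m i))

nΔ : ℕ → ℕ
nΔ Δ = 2 ^ Δ ∸ 1

-- exponent of the k-th generator, k = 1..Δ, indexed by j = k-1 : Fin Δ
genExp : ℕ → ℕ
genExp j = 2 ^ j ∸ 1

CayleyGraph : ℕ → Graph
CayleyGraph Δ = record
  { order = nΔ Δ + nΔ Δ
  ; adj   = λ a b → ⌊ any? (λ (j : Fin Δ) → mulWX (nΔ Δ) a (genExp (toℕ j)) ≟ b) ⌋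
  }

-- In a graph of maximum degree d + 1, capacity d c s bounds the number of vertices
-- that can be informed through a vertex with c uninformed neighbours and s rounds to go: a call
-- uses up one of the c neighbours and creates a vertex with at most d uninformed neighbours, so
-- capacity d (c + 1) (s + 1) = capacity d c s + capacity d d s.  The sum of the capacities of the
-- informed vertices never increases from one round to the next, so a graph of broadcast time t
-- has at most capacity d (d + 1) t vertices, which is 2 (2^(d+1) - 1) for t = d + 2.
--
-- Left
-- translations are automorphisms, so it suffices to broadcast from e.  In round q < Δ every
-- informed vertex calls along w x^(2^q - 1), which sends exponent i < 2^(q-1) to the new exponent
-- 2^q - 1 - i; thus after q + 1 rounds exactly the exponents below 2^q are informed.  The last
-- round calls along w, sending i to n - i and reaching the remaining exponents 2^(Δ-1), ..., n - 1.

module Submission where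

open import Defs
open import Data.Nat using (ℕ; suc; _∸_; _^_; _+_; _≤_)
open import Data.Product using (_×_)
open import Relation.Binary.PropositionalEquality using (_≡_)

open import Data.Bool using (Bool; true; false; not; T; _∧_; _∨_; if_then_else_)
open import Data.Empty using (⊥; ⊥-elim)
open import Data.Fin using (Fin; zero; suc; toℕ; fromℕ<; splitAt; join; _≟_)
open import Data.Fin.Properties using (any?; toℕ-fromℕ<; toℕ-injective; toℕ<n; splitAt-join; join-splitAt)
import Data.Fin.Properties as Fin
open import Data.List using (length; filterᵇ; allFin; tabulate)
open import Data.Maybe using (Maybe; just; nothing)
open import Data.Maybe.Properties using (≡-dec)
open import Data.Nat hiding (_≟_)
open import Data.Nat.DivMod
open import Data.Nat.Properties hiding (_≟_)
open import Algebra.Properties.CommutativeMonoid.Sum +-0-commutativeMonoid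
  using (sum; sum-cong-≗; sum-replicate-zero; ∑-distrib-+; ∑-comm)
open import Algebra.Properties.CommutativeSemigroup +-commutativeSemigroup
  using (xy∙z≈xz∙y)
open import Data.Product using (∃; _,_; proj₁; proj₂)
open import Data.Sum using (_⊎_; inj₁; inj₂)
open import Data.Sum.Properties using (inj₁-injective)
import Data.Sum.Properties as Sum
open import Data.Unit using (tt)
open import Function using (_∘_; _∘′_)
open import Function.Bundles using (mk⇔)
open import Function.Definitions using (Injective)
open import Relation.Binary.Definitions using (tri<; tri≈; tri>)
open import Relation.Binary.PropositionalEquality
open import Relation.Nullary using (Dec; yes; no; does; ¬_)
open import Relation.Nullary.Decidable
  using (⌊_⌋; _⊎-dec_; _×-dec_; fromWitness; toWitness; isYes≗does; does-⇔; dec-true; dec-false)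

-- Finite sums

indicator : Bool → ℕ
indicator b = if b then 1 else 0

indicator-∨ : ∀ a b → (T a → T b → ⊥) → indicator (a ∨ b) ≡ indicator a + indicator b
indicator-∨ true  true  disjoint = ⊥-elim (disjoint tt tt)
indicator-∨ true  false disjoint = refl
indicator-∨ false b     disjoint = refl

indicator-∧-not-≤ : ∀ a b → indicator (a ∧ not b) ≤ indicator a
indicator-∧-not-≤ true  true  = z≤n
indicator-∧-not-≤ true  false = ≤-refl
indicator-∧-not-≤ false b     = ≤-refl

indicator-∧-not-antimono : ∀ a {b b′} → (b ≡ true → b′ ≡ true) → indicator (a ∧ not b′) ≤ indicator (a ∧ not b)
indicator-∧-not-antimono false         b⇒b′ = ≤-refl
indicator-∧-not-antimono true {true}  b⇒b′ rewrite b⇒b′ refl = ≤-refl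
indicator-∧-not-antimono true {false} {true}  b⇒b′ = z≤n
indicator-∧-not-antimono true {false} {false} b⇒b′ = ≤-refl

sum-mono-≤ : ∀ {N} {f g : Fin N → ℕ} → (∀ x → f x ≤ g x) → sum f ≤ sum g
sum-mono-≤ {zero}  f≤g = z≤n
sum-mono-≤ {suc N} f≤g = +-mono-≤ (f≤g zero) (sum-mono-≤ (f≤g ∘ suc))

sum-mono-< : ∀ {N} {f g : Fin N → ℕ} → (∀ x → f x ≤ g x) → ∀ y → f y < g y → sum f < sum g
sum-mono-< {suc N} f≤g zero    fy<gy = +-mono-<-≤ fy<gy (sum-mono-≤ (f≤g ∘ suc))
sum-mono-< {suc N} f≤g (suc y) fy<gy = +-mono-≤-< (f≤g zero) (sum-mono-< (f≤g ∘ suc) y fy<gy)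

f≤sum : ∀ {N} (f : Fin N → ℕ) x → f x ≤ sum f
f≤sum f zero    = m≤m+n _ _
f≤sum f (suc x) = ≤-trans (f≤sum (f ∘ suc) x) (m≤n+m _ _)

sum-zero : ∀ {N} {f : Fin N → ℕ} → (∀ x → f x ≡ 0) → sum f ≡ 0
sum-zero {zero}  f≡0 = refl
sum-zero {suc N} f≡0 = cong₂ _+_ (f≡0 zero) (sum-zero (f≡0 ∘ suc))

sum-const-1 : ∀ N → sum {N} (λ _ → 1) ≡ N
sum-const-1 zero    = refl
sum-const-1 (suc N) = cong suc (sum-const-1 N)

sum-single : ∀ {N} (c : Fin N) (f : Fin N → ℕ) → (∀ x → c ≢ x → f x ≡ 0) → sum f ≡ f c
sum-single zero    f f≡0 = trans (cong (f zero +_) (sum-zero (λ x → f≡0 (suc x) λ ()))) (+-identityʳ _)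
sum-single (suc c) f f≡0 = trans (cong (_+ sum (f ∘ suc)) (f≡0 zero λ ()))
                                 (sum-single c (f ∘ suc) λ x c≢x → f≡0 (suc x) (c≢x ∘ Fin.suc-injective))

length-filterᵇ-allFin : ∀ N (p : Fin N → Bool) → length (filterᵇ p (allFin N)) ≡ sum (indicator ∘ p)
length-filterᵇ-allFin N p = go N (λ x → x)
  where
  go : ∀ M (f : Fin M → Fin N) → length (filterᵇ p (tabulate f)) ≡ sum (indicator ∘ p ∘ f)
  go zero    f = refl
  go (suc M) f with p (f zero)
  ... | true  = cong suc (go M (f ∘ suc))
  ... | false = go M (f ∘ suc)

sum-if-≟ : ∀ {N} (c : Fin N) (f : Fin N → ℕ) → sum (λ x → if ⌊ c ≟ x ⌋ then f x else 0) ≡ f c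
sum-if-≟ c f = trans (sum-single c _ off) on
  where
  off : ∀ x → c ≢ x → (if ⌊ c ≟ x ⌋ then f x else 0) ≡ 0
  off x c≢x with c ≟ x
  ... | yes c≡x = ⊥-elim (c≢x c≡x)
  ... | no _    = refl
  on : (if ⌊ c ≟ c ⌋ then f c else 0) ≡ f c
  on with c ≟ c
  ... | yes _   = refl
  ... | no c≢c = ⊥-elim (c≢c refl)

module _ {N : ℕ} where

  inImage : ∀ {D} → (Fin D → Fin N) → Fin N → Bool
  inImage f y = ⌊ any? (λ x → f x ≟ y) ⌋

  imageSize : ∀ {D} → (Fin D → Fin N) → ℕ
  imageSize f = sum (indicator ∘ inImage f)

  inImage-suc : ∀ {D} (f : Fin (suc D) → Fin N) y → inImage f y ≡ ⌊ f zero ≟ y ⌋ ∨ inImage (f ∘ suc) y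
  inImage-suc f y with f zero ≟ y | any? (λ x → f (suc x) ≟ y)
  ... | yes _ | _     = refl
  ... | no _  | yes _ = refl
  ... | no _  | no _  = refl

  imageSize-suc : ∀ {D} (f : Fin (suc D) → Fin N) →
    imageSize f ≡ sum (λ y → indicator (⌊ f zero ≟ y ⌋ ∨ inImage (f ∘ suc) y))
  imageSize-suc f = sum-cong-≗ (cong indicator ∘ inImage-suc f)

  imageSize-injective : ∀ {D} (f : Fin D → Fin N) → Injective _≡_ _≡_ f → imageSize f ≡ D
  imageSize-injective {zero}  f inj = sum-replicate-zero N
  imageSize-injective {suc D} f inj = begin
    imageSize f
      ≡⟨ imageSize-suc f ⟩
    sum (λ y → indicator (⌊ f zero ≟ y ⌋ ∨ inImage (f ∘ suc) y))
      ≡⟨ sum-cong-≗ (λ y → indicator-∨ _ _ (disjoint y)) ⟩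
    sum (λ y → indicator ⌊ f zero ≟ y ⌋ + indicator (inImage (f ∘ suc) y))
      ≡⟨ ∑-distrib-+ (λ y → indicator ⌊ f zero ≟ y ⌋) (indicator ∘ inImage (f ∘ suc)) ⟩
    sum (λ y → indicator ⌊ f zero ≟ y ⌋) + imageSize (f ∘ suc)
      ≡⟨ cong₂ _+_ (sum-if-≟ (f zero) (λ _ → 1)) (imageSize-injective (f ∘ suc) (Fin.suc-injective ∘ inj)) ⟩
    suc D ∎
    where
    open ≡-Reasoning
    disjoint : ∀ y → T ⌊ f zero ≟ y ⌋ → T (inImage (f ∘ suc) y) → ⊥
    disjoint y f0≡y fx≡y with toWitness fx≡y
    ... | x , fx≡y′ with inj (trans (toWitness f0≡y) (sym fx≡y′))
    ... | ()

-- Broadcasting in arbitrary graphs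

known⇒reach : ∀ (G : Graph) {u σ t} → ValidSchedule G u σ t →
              ∀ {i v} → i ≤ t → Known G u σ i v → Reach G u v
known⇒reach G valid {zero}  _   refl = here
known⇒reach G valid {suc i} i<t (inj₁ v∈) = known⇒reach G valid (<⇒≤ i<t) v∈
known⇒reach G valid {suc i} i<t (inj₂ (w , w∈ , w→v)) =
  reach-snoc (known⇒reach G valid (<⇒≤ i<t) w∈) (proj₁ (proj₂ (valid i i<t w _ w→v)))
  where
  reach-snoc : ∀ {a b c} → Reach G a b → Adj G b c → Reach G a c
  reach-snoc here         b~c = step b~c here
  reach-snoc (step a~x r) b~c = step a~x (reach-snoc r b~c)

capacity : ℕ → ℕ → ℕ → ℕ
capacity d zero    s       = 1
capacity d (suc c) zero    = 1
capacity d (suc c) (suc s) = capacity d c s + capacity d d s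

capacity≥1 : ∀ d c s → 1 ≤ capacity d c s
capacity≥1 d zero    s       = s≤s z≤n
capacity≥1 d (suc c) zero    = s≤s z≤n
capacity≥1 d (suc c) (suc s) = ≤-trans (capacity≥1 d c s) (m≤m+n _ _)

capacity-mono : ∀ d {c c′ s s′} → c ≤ c′ → s ≤ s′ → capacity d c s ≤ capacity d c′ s′
capacity-mono d {zero}  {c′}     {s}     {s′}     _          _          = capacity≥1 d c′ s′
capacity-mono d {suc c} {suc c′} {zero}  {s′}     _          _          = capacity≥1 d (suc c′) s′
capacity-mono d {suc c} {suc c′} {suc s} {suc s′} (s≤s c≤c′) (s≤s s≤s′) =
  +-mono-≤ (capacity-mono d c≤c′ s≤s′) (capacity-mono d {d} ≤-refl s≤s′)

capacity-0 : ∀ d c → capacity d c 0 ≡ 1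
capacity-0 d zero    = refl
capacity-0 d (suc c) = refl

capacity≡2^ : ∀ d c s → s ≤ c → s ≤ suc d → capacity d c s ≡ 2 ^ s
capacity≡2^ d zero    zero    _          _          = refl
capacity≡2^ d (suc c) zero    _          _          = refl
capacity≡2^ d (suc c) (suc s) (s≤s s≤c) (s≤s s≤d) =
  cong₂ _+_ (capacity≡2^ d c s s≤c (m≤n⇒m≤1+n s≤d))
            (trans (capacity≡2^ d d s s≤d (m≤n⇒m≤1+n s≤d)) (sym (+-identityʳ _)))

capacity-suc+1≡2^ : ∀ d c → c ≤ d → capacity d c (suc c) + 1 ≡ 2 ^ suc c
capacity-suc+1≡2^ d zero    _   = refl
capacity-suc+1≡2^ d (suc c) c<d = begin
  capacity d c (suc c) + capacity d d (suc c) + 1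
    ≡⟨ xy∙z≈xz∙y (capacity d c (suc c)) _ 1 ⟩
  capacity d c (suc c) + 1 + capacity d d (suc c)
    ≡⟨ cong₂ _+_ (capacity-suc+1≡2^ d c (<⇒≤ c<d)) (capacity≡2^ d d (suc c) c<d (m≤n⇒m≤1+n c<d)) ⟩
  2 ^ suc c + 2 ^ suc c
    ≡⟨ cong (2 ^ suc c +_) (sym (+-identityʳ _)) ⟩
  2 ^ suc (suc c) ∎
  where open ≡-Reasoning

capacity-diagonal : ∀ d → capacity d d (suc d) ≡ 2 ^ suc d ∸ 1
capacity-diagonal d = trans (sym (m+n∸n≡m _ 1)) (cong (_∸ 1) (capacity-suc+1≡2^ d d ≤-refl))

capacity-split : ∀ d {a b c s} → a < c → b ≤ d → capacity d a s + capacity d b s ≤ capacity d c (suc s)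
capacity-split d {c = suc c} (s≤s a≤c) b≤d = +-mono-≤ (capacity-mono d a≤c ≤-refl) (capacity-mono d b≤d ≤-refl)

module Potential (H : Graph) (symm : ∀ a b → adj H a b ≡ adj H b a) (d : ℕ)
                 (degree≤ : ∀ v → degree H v ≤ suc d)
                 {u : Fin (order H)} {σ : Schedule H} {t : ℕ} (valid : ValidSchedule H u σ t) where

  known? : ∀ i v → Dec (Known H u σ i v)
  known? zero    v = v ≟ u
  known? (suc i) v = known? i v ⊎-dec any? (λ w → known? i w ×-dec ≡-dec _≟_ (σ i w) (just v))

  informed : ℕ → Fin (order H) → Bool
  informed i v = does (known? i v)

  informed-true : ∀ {i v} → Known H u σ i v → informed i v ≡ true
  informed-true {i} {v} = dec-true (known? i v)

  informed-suc : ∀ i v → informed i v ≡ true → informed (suc i) v ≡ true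
  informed-suc i v k rewrite k = refl

  uninformedNeighbours : ℕ → Fin (order H) → ℕ
  uninformedNeighbours i v = sum (λ w → indicator (adj H v w ∧ not (informed i w)))

  uninformedNeighbours≤degree : ∀ i v → uninformedNeighbours i v ≤ degree H v
  uninformedNeighbours≤degree i v = begin
    uninformedNeighbours i v  ≤⟨ sum-mono-≤ (λ w → indicator-∧-not-≤ (adj H v w) (informed i w)) ⟩
    sum (indicator ∘ adj H v) ≡⟨ length-filterᵇ-allFin (order H) (adj H v) ⟨
    degree H v                ∎
    where open ≤-Reasoning

  uninformedNeighbours-suc : ∀ i v → uninformedNeighbours (suc i) v ≤ uninformedNeighbours i v
  uninformedNeighbours-suc i v =
    sum-mono-≤ (λ w → indicator-∧-not-antimono (adj H v w) (informed-suc i w))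

  uninformedNeighbours-suc-< : ∀ i v x → Adj H v x → informed i x ≡ false → informed (suc i) x ≡ true →
    uninformedNeighbours (suc i) v < uninformedNeighbours i v
  uninformedNeighbours-suc-< i v x v~x x∉ x∈ =
    sum-mono-< (λ w → indicator-∧-not-antimono (adj H v w) (informed-suc i w)) x (newly (adj H v x) v~x)
    where
    newly : ∀ b → T b → indicator (b ∧ not (informed (suc i) x)) < indicator (b ∧ not (informed i x))
    newly true _ rewrite x∉ | x∈ = s≤s z≤n

  uninformedNeighbours<degree : ∀ i v x → Adj H v x → informed i x ≡ true → uninformedNeighbours i v < degree H v
  uninformedNeighbours<degree i v x v~x x∈ = begin-strict
    uninformedNeighbours i v
      <⟨ sum-mono-< (λ w → indicator-∧-not-≤ (adj H v w) (informed i w)) x (known (adj H v x) v~x) ⟩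
    sum (indicator ∘ adj H v)
      ≡⟨ length-filterᵇ-allFin (order H) (adj H v) ⟨
    degree H v ∎
    where
    open ≤-Reasoning
    known : ∀ b → T b → indicator (b ∧ not (informed i x)) < indicator b
    known true _ rewrite x∈ = s≤s z≤n

  potential : ℕ → ℕ → ℕ
  potential i s = sum (λ v → indicator (informed i v) * capacity d (uninformedNeighbours i v) s)

  module _ (i : ℕ) (i<t : i < t) (s : ℕ) where
    private
      c c′ : Fin (order H) → ℕ
      c  = uninformedNeighbours i
      c′ = uninformedNeighbours (suc i)

      -- A vertex first informed in round i is charged to the vertex that called it.
      newcomerCharge : Fin (order H) → ℕ
      newcomerCharge v = if informed i v then 0 else capacity d (c′ v) s

      callCharge : Maybe (Fin (order H)) → ℕ
      callCharge nothing  = 0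
      callCharge (just v) = newcomerCharge v

      chargeIfCalled : Maybe (Fin (order H)) → Fin (order H) → ℕ
      chargeIfCalled nothing  v = 0
      chargeIfCalled (just x) v = if ⌊ x ≟ v ⌋ then newcomerCharge v else 0

      charge : Fin (order H) → Fin (order H) → ℕ
      charge w v = if informed i w then chargeIfCalled (σ i w) v else 0

      selfCharge : Fin (order H) → ℕ
      selfCharge v = indicator (informed i v) * capacity d (c′ v) s

      sum-charge : ∀ w → sum (charge w) ≡ (if informed i w then callCharge (σ i w) else 0)
      sum-charge w with informed i w | σ i w
      ... | false | _        = sum-replicate-zero (order H)
      ... | true  | nothing  = sum-replicate-zero (order H)
      ... | true  | just v   = sum-if-≟ v newcomerCharge

      charged-to-caller : ∀ v → indicator (informed (suc i) v) * capacity d (c′ v) s ≤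
                                selfCharge v + sum (λ w → charge w v)
      charged-to-caller v with known? i v in v?
      ... | yes _ = m≤m+n _ _
      ... | no _ with any? (λ w → known? i w ×-dec ≡-dec _≟_ (σ i w) (just v))
      ...   | no _                 = z≤n
      ...   | yes (w , w∈ , w→v) = begin
        capacity d (c′ v) s + 0 ≡⟨ +-identityʳ _ ⟩
        capacity d (c′ v) s     ≡⟨ charge-caller ⟨
        charge w v               ≤⟨ f≤sum (λ w → charge w v) w ⟩
        sum (λ w → charge w v)   ∎
        where
        open ≤-Reasoning
        charge-caller : charge w v ≡ capacity d (c′ v) s
        charge-caller rewrite informed-true w∈ | w→v with v ≟ v
        ... | yes _   rewrite v? = refl
        ... | no v≢v = ⊥-elim (v≢v refl)

      keeps : ∀ w → capacity d (c′ w) s ≤ capacity d (c w) (suc s)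
      keeps w = capacity-mono d (uninformedNeighbours-suc i w) (n≤1+n s)

      caller-bound : ∀ w → selfCharge w + (if informed i w then callCharge (σ i w) else 0) ≤
                           indicator (informed i w) * capacity d (c w) (suc s)
      caller-bound w with known? i w
      ... | no _   = z≤n
      ... | yes w∈ with σ i w in σw
      ...   | nothing = +-monoˡ-≤ 0 (≤-trans (≤-reflexive (+-identityʳ _)) (keeps w))
      ...   | just v with informed i v in v?
      ...     | true  = +-monoˡ-≤ 0 (≤-trans (≤-reflexive (+-identityʳ _)) (keeps w))
      ...     | false = ≤-trans (≤-reflexive (cong (_+ capacity d (c′ v) s) (+-identityʳ _)))
                                (≤-trans (capacity-split d c′w<cw c′v≤d) (m≤m+n _ 0))
        where
        w~v : Adj H w v
        w~v = proj₁ (proj₂ (valid i i<t w v σw))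
        v∈ : informed (suc i) v ≡ true
        v∈ = informed-true (inj₂ (w , w∈ , σw))
        c′w<cw : c′ w < c w
        c′w<cw = uninformedNeighbours-suc-< i w v w~v v? v∈
        c′v≤d : c′ v ≤ d
        c′v≤d = s≤s⁻¹ (≤-trans (uninformedNeighbours<degree (suc i) v w (subst T (symm w v) w~v)
                                   (informed-suc i w (informed-true w∈)))
                                 (degree≤ v))

    potential-round : potential (suc i) s ≤ potential i (suc s)
    potential-round = begin
      potential (suc i) s
        ≤⟨ sum-mono-≤ charged-to-caller ⟩
      sum (λ v → selfCharge v + sum (λ w → charge w v))
        ≡⟨ ∑-distrib-+ selfCharge _ ⟩
      sum selfCharge + sum (λ v → sum (λ w → charge w v))
        ≡⟨ cong (sum selfCharge +_) (∑-comm charge) ⟨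
      sum selfCharge + sum (λ w → sum (charge w))
        ≡⟨ cong (sum selfCharge +_) (sum-cong-≗ sum-charge) ⟩
      sum selfCharge + sum (λ w → if informed i w then callCharge (σ i w) else 0)
        ≡⟨ ∑-distrib-+ selfCharge _ ⟨
      sum (λ w → selfCharge w + (if informed i w then callCharge (σ i w) else 0))
        ≤⟨ sum-mono-≤ caller-bound ⟩
      potential i (suc s) ∎
      where open ≤-Reasoning

  potential-rounds : ∀ s i → i + s ≡ t → potential t 0 ≤ potential i s
  potential-rounds zero    i i+0≡t rewrite +-identityʳ i | i+0≡t = ≤-refl
  potential-rounds (suc s) i i+s≡t = ≤-trans (potential-rounds s (suc i) i+s≡t′) (potential-round i i<t s)
    where
    i+s≡t′ : suc i + s ≡ t
    i+s≡t′ = trans (sym (+-suc i s)) i+s≡t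
    i<t : i < t
    i<t = ≤-trans (s≤s (m≤m+n i s)) (≤-reflexive i+s≡t′)

≡0⊎Fin : ∀ n → n ≡ 0 ⊎ Fin n
≡0⊎Fin zero    = inj₁ refl
≡0⊎Fin (suc n) = inj₂ zero

order≤capacity : ∀ (H : Graph) d → (∀ a b → adj H a b ≡ adj H b a) → (∀ v → degree H v ≤ suc d) →
                 ∀ {u t} → BroadcastFromWithin H u t → order H ≤ capacity d (suc d) t
order≤capacity H d symm degree≤ {u} {t} (σ , valid , allKnown) = begin
  order H
    ≡⟨ sum-const-1 (order H) ⟨
  sum {order H} (λ _ → 1)
    ≤⟨ sum-mono-≤ informed-at-end ⟩
  potential t 0
    ≤⟨ potential-rounds t 0 refl ⟩
  potential 0 t
    ≡⟨ sum-single u _ only-source ⟩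
  indicator (informed 0 u) * capacity d (uninformedNeighbours 0 u) t
    ≡⟨ cong (λ b → indicator b * capacity d (uninformedNeighbours 0 u) t) (informed-true refl) ⟩
  1 * capacity d (uninformedNeighbours 0 u) t
    ≡⟨ *-identityˡ _ ⟩
  capacity d (uninformedNeighbours 0 u) t
    ≤⟨ capacity-mono d (≤-trans (uninformedNeighbours≤degree 0 u) (degree≤ u)) ≤-refl ⟩
  capacity d (suc d) t ∎
  where
  open ≤-Reasoning
  open Potential H symm d degree≤ valid
  informed-at-end : ∀ v → 1 ≤ indicator (informed t v) * capacity d (uninformedNeighbours t v) 0
  informed-at-end v rewrite informed-true (allKnown v) | capacity-0 d (uninformedNeighbours t v) = s≤s z≤n
  only-source : ∀ v → u ≢ v → indicator (informed 0 v) * capacity d (uninformedNeighbours 0 v) t ≡ 0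
  only-source v u≢v with v ≟ u
  ... | yes v≡u = ⊥-elim (u≢v (sym v≡u))
  ... | no _    = refl

broadcastTime⇒order≤capacity : ∀ (H : Graph) d → (∀ a b → adj H a b ≡ adj H b a) → (∀ v → degree H v ≤ suc d) →
                               ∀ {t} → BroadcastTimeAtMost H t → order H ≤ capacity d (suc d) t
broadcastTime⇒order≤capacity H d symm degree≤ broadcast with ≡0⊎Fin (order H)
... | inj₁ order≡0 = ≤-trans (≤-reflexive order≡0) z≤n
... | inj₂ u       = order≤capacity H d symm degree≤ (broadcast u)

-- Arithmetic

2*P∸P≡P : ∀ P → 2 * P ∸ P ≡ P
2*P∸P≡P P = trans (m+n∸m≡n P (P + 0)) (+-identityʳ P)

i<P⇒P≤2*P∸1∸i : ∀ {i P} → i < P → P ≤ 2 * P ∸ 1 ∸ i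
i<P⇒P≤2*P∸1∸i {i} {P} i<P = begin
  P             ≡⟨ 2*P∸P≡P P ⟨
  2 * P ∸ P     ≤⟨ ∸-monoʳ-≤ (2 * P) i<P ⟩
  2 * P ∸ suc i ≡⟨ ∸-+-assoc (2 * P) 1 i ⟨
  2 * P ∸ 1 ∸ i ∎
  where open ≤-Reasoning

P≤i<2*P⇒2*P∸1∸i<P : ∀ {i P} → P ≤ i → i < 2 * P → 2 * P ∸ 1 ∸ i < P
P≤i<2*P⇒2*P∸1∸i<P {i} {P} P≤i i<2P = begin-strict
  2 * P ∸ 1 ∸ i ≡⟨ ∸-+-assoc (2 * P) 1 i ⟩
  2 * P ∸ suc i <⟨ ∸-monoʳ-< (s≤s P≤i) i<2P ⟩
  2 * P ∸ P     ≡⟨ 2*P∸P≡P P ⟩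
  P             ∎
  where open ≤-Reasoning

2^-injective : ∀ {a b} → 2 ^ a ≡ 2 ^ b → a ≡ b
2^-injective {a} {b} eq with <-cmp a b
... | tri< a<b _ _ = ⊥-elim (<-irrefl eq (^-monoʳ-< 2 (s≤s (s≤s z≤n)) a<b))
... | tri≈ _ a≡b _ = a≡b
... | tri> _ _ b<a = ⊥-elim (<-irrefl (sym eq) (^-monoʳ-< 2 (s≤s (s≤s z≤n)) b<a))

genExp-injective : ∀ {a b} → genExp a ≡ genExp b → a ≡ b
genExp-injective {a} {b} eq = 2^-injective (∸-cancelʳ-≡ (m^n>0 2 a) (m^n>0 2 b) eq)

module ModularSubtraction (n : ℕ) .{{_ : NonZero n}} where

  -- (m - i) mod n for i ≤ n, as in subMod of Defs.
  infixl 7 _⊖_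
  _⊖_ : ℕ → ℕ → ℕ
  m ⊖ i = (m + n ∸ i) % n

  [m%n+k]%n≡[m+k]%n : ∀ m k → (m % n + k) % n ≡ (m + k) % n
  [m%n+k]%n≡[m+k]%n m k = begin
    (m % n + k) % n         ≡⟨ %-distribˡ-+ (m % n) k n ⟩
    (m % n % n + k % n) % n ≡⟨ cong (λ x → (x + k % n) % n) (m%n%n≡m%n m n) ⟩
    (m % n + k % n) % n     ≡⟨ %-distribˡ-+ m k n ⟨
    (m + k) % n             ∎
    where open ≡-Reasoning

  [m+k%n]%n≡[m+k]%n : ∀ m k → (m + k % n) % n ≡ (m + k) % n
  [m+k%n]%n≡[m+k]%n m k = begin
    (m + k % n) % n ≡⟨ cong (_% n) (+-comm m (k % n)) ⟩
    (k % n + m) % n ≡⟨ [m%n+k]%n≡[m+k]%n k m ⟩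
    (k + m) % n     ≡⟨ cong (_% n) (+-comm k m) ⟩
    (m + k) % n     ∎
    where open ≡-Reasoning

  ⊖<n : ∀ m i → m ⊖ i < n
  ⊖<n m i = m%n<n (m + n ∸ i) n

  [m⊖i+i]%n≡m%n : ∀ m i → i ≤ n → (m ⊖ i + i) % n ≡ m % n
  [m⊖i+i]%n≡m%n m i i≤n = begin
    (m ⊖ i + i) % n     ≡⟨ [m%n+k]%n≡[m+k]%n (m + n ∸ i) i ⟩
    (m + n ∸ i + i) % n ≡⟨ cong (_% n) (m∸n+n≡m (≤-trans i≤n (m≤n+m n m))) ⟩
    (m + n) % n         ≡⟨ [m+n]%n≡m%n m n ⟩
    m % n               ∎
    where open ≡-Reasoning

  ⊖-cong-% : ∀ m i → i ≤ n → m % n ⊖ i ≡ m ⊖ i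
  ⊖-cong-% m i i≤n = begin
    (m % n + n ∸ i) % n   ≡⟨ cong (_% n) (+-∸-assoc (m % n) i≤n) ⟩
    (m % n + (n ∸ i)) % n ≡⟨ [m%n+k]%n≡[m+k]%n m (n ∸ i) ⟩
    (m + (n ∸ i)) % n     ≡⟨ cong (_% n) (+-∸-assoc m i≤n) ⟨
    (m + n ∸ i) % n       ∎
    where open ≡-Reasoning

  [x+i]⊖i≡x : ∀ x i → x < n → (x + i) ⊖ i ≡ x
  [x+i]⊖i≡x x i x<n = begin
    (x + i + n ∸ i) % n ≡⟨ cong (λ y → (y ∸ i) % n) (+-comm (x + i) n) ⟩
    (n + (x + i) ∸ i) % n ≡⟨ cong (λ y → (y ∸ i) % n) (+-assoc n x i) ⟨
    (n + x + i ∸ i) % n ≡⟨ cong (_% n) (m+n∸n≡m (n + x) i) ⟩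
    (n + x) % n         ≡⟨ cong (_% n) (+-comm n x) ⟩
    (x + n) % n         ≡⟨ [m+n]%n≡m%n x n ⟩
    x % n               ≡⟨ m<n⇒m%n≡m x<n ⟩
    x                   ∎
    where open ≡-Reasoning

  ⊖-unique : ∀ {m i x} → i ≤ n → x < n → (x + i) % n ≡ m % n → m ⊖ i ≡ x
  ⊖-unique {m} {i} {x} i≤n x<n x+i≡m = begin
    m ⊖ i         ≡⟨ ⊖-cong-% m i i≤n ⟨
    m % n ⊖ i     ≡⟨ cong (_⊖ i) x+i≡m ⟨
    (x + i) % n ⊖ i ≡⟨ ⊖-cong-% (x + i) i i≤n ⟩
    (x + i) ⊖ i   ≡⟨ [x+i]⊖i≡x x i x<n ⟩
    x             ∎
    where open ≡-Reasoning

  ⊖-involutive : ∀ m {i} → i < n → m ⊖ (m ⊖ i) ≡ i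
  ⊖-involutive m {i} i<n = ⊖-unique (<⇒≤ (⊖<n m i)) i<n (begin
    (i + m ⊖ i) % n ≡⟨ cong (_% n) (+-comm i (m ⊖ i)) ⟩
    (m ⊖ i + i) % n ≡⟨ [m⊖i+i]%n≡m%n m i (<⇒≤ i<n) ⟩
    m % n           ∎)
    where open ≡-Reasoning

  [m⊖i+k]%n≡m⊖[i⊖k] : ∀ m {i k} → i ≤ n → k ≤ n → (m ⊖ i + k) % n ≡ m ⊖ (i ⊖ k)
  [m⊖i+k]%n≡m⊖[i⊖k] m {i} {k} i≤n k≤n = sym (⊖-unique (<⇒≤ (⊖<n i k)) (m%n<n _ n) (begin
    ((m ⊖ i + k) % n + i ⊖ k) % n   ≡⟨ [m%n+k]%n≡[m+k]%n (m ⊖ i + k) (i ⊖ k) ⟩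
    (m ⊖ i + k + i ⊖ k) % n         ≡⟨ cong (_% n) (+-assoc (m ⊖ i) k (i ⊖ k)) ⟩
    (m ⊖ i + (k + i ⊖ k)) % n       ≡⟨ cong (λ x → (m ⊖ i + x) % n) (+-comm k (i ⊖ k)) ⟩
    (m ⊖ i + (i ⊖ k + k)) % n       ≡⟨ [m+k%n]%n≡[m+k]%n (m ⊖ i) (i ⊖ k + k) ⟨
    (m ⊖ i + (i ⊖ k + k) % n) % n   ≡⟨ cong (λ x → (m ⊖ i + x) % n) ([m⊖i+i]%n≡m%n i k k≤n) ⟩
    (m ⊖ i + i % n) % n             ≡⟨ [m+k%n]%n≡[m+k]%n (m ⊖ i) i ⟩
    (m ⊖ i + i) % n                 ≡⟨ [m⊖i+i]%n≡m%n m i i≤n ⟩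
    m % n                           ∎))
    where open ≡-Reasoning

  [m⊖i]⊖k≡m⊖[i+k]%n : ∀ m {i k} → i ≤ n → k ≤ n → m ⊖ i ⊖ k ≡ m ⊖ ((i + k) % n)
  [m⊖i]⊖k≡m⊖[i+k]%n m {i} {k} i≤n k≤n = sym (⊖-unique (m%n≤n (i + k) n) (⊖<n (m ⊖ i) k) (begin
    (m ⊖ i ⊖ k + (i + k) % n) % n   ≡⟨ [m+k%n]%n≡[m+k]%n (m ⊖ i ⊖ k) (i + k) ⟩
    (m ⊖ i ⊖ k + (i + k)) % n       ≡⟨ cong (λ x → (m ⊖ i ⊖ k + x) % n) (+-comm i k) ⟩
    (m ⊖ i ⊖ k + (k + i)) % n       ≡⟨ cong (_% n) (+-assoc (m ⊖ i ⊖ k) k i) ⟨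
    (m ⊖ i ⊖ k + k + i) % n         ≡⟨ [m%n+k]%n≡[m+k]%n (m ⊖ i ⊖ k + k) i ⟨
    ((m ⊖ i ⊖ k + k) % n + i) % n   ≡⟨ cong (λ x → (x + i) % n) ([m⊖i+i]%n≡m%n (m ⊖ i) k k≤n) ⟩
    ((m ⊖ i) % n + i) % n           ≡⟨ [m%n+k]%n≡[m+k]%n (m ⊖ i) i ⟩
    (m ⊖ i + i) % n                 ≡⟨ [m⊖i+i]%n≡m%n m i i≤n ⟩
    m % n                           ∎))
    where open ≡-Reasoning

  ⊖-cancelʳ : ∀ {m₁ m₂ i} → m₁ < n → m₂ < n → i ≤ n → m₁ ⊖ i ≡ m₂ ⊖ i → m₁ ≡ m₂
  ⊖-cancelʳ {m₁} {m₂} {i} m₁<n m₂<n i≤n eq = begin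
    m₁               ≡⟨ m<n⇒m%n≡m m₁<n ⟨
    m₁ % n           ≡⟨ [m⊖i+i]%n≡m%n m₁ i i≤n ⟨
    (m₁ ⊖ i + i) % n ≡⟨ cong (λ x → (x + i) % n) eq ⟩
    (m₂ ⊖ i + i) % n ≡⟨ [m⊖i+i]%n≡m%n m₂ i i≤n ⟩
    m₂ % n           ≡⟨ m<n⇒m%n≡m m₂<n ⟩
    m₂               ∎
    where open ≡-Reasoning

  i⊖i≡0 : ∀ i → i ⊖ i ≡ 0
  i⊖i≡0 i = trans (cong (_% n) (m+n∸m≡n i n)) (n%n≡0 n)

  m⊖i≡0⇒m≡i : ∀ {m i} → m < n → i < n → m ⊖ i ≡ 0 → m ≡ i
  m⊖i≡0⇒m≡i {i = i} m<n i<n m⊖i≡0 = ⊖-cancelʳ m<n i<n (<⇒≤ i<n) (trans m⊖i≡0 (sym (i⊖i≡0 i)))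

-- The dihedral group

module Dihedral (k : ℕ) where

  open ModularSubtraction (suc k)

  -- inj₁ i is x^i and inj₂ i is w x^i; splitAt translates the vertices of Defs into this form.
  Element : Set
  Element = Fin (suc k) ⊎ Fin (suc k)

  e : Element
  e = inj₁ zero

  exponent : Element → ℕ
  exponent (inj₁ i) = toℕ i
  exponent (inj₂ i) = toℕ i

  exponent<n : ∀ a → exponent a < suc k
  exponent<n (inj₁ i) = toℕ<n i
  exponent<n (inj₂ i) = toℕ<n i

  toℕ-subMod : ∀ m (i : Fin (suc k)) → toℕ (subMod m i) ≡ m ⊖ toℕ i
  toℕ-subMod m i = toℕ-fromℕ< _

  infixl 7 _·wx^_
  _·wx^_ : Element → ℕ → Element
  inj₁ i ·wx^ m = inj₂ (subMod m i)
  inj₂ i ·wx^ m = inj₁ (subMod m i)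

  exponent-·wx^ : ∀ a m → exponent (a ·wx^ m) ≡ m ⊖ exponent a
  exponent-·wx^ (inj₁ i) m = toℕ-subMod m i
  exponent-·wx^ (inj₂ i) m = toℕ-subMod m i

  ·wx^-≢ : ∀ a m → a ·wx^ m ≢ a
  ·wx^-≢ (inj₁ i) m ()
  ·wx^-≢ (inj₂ i) m ()

  subMod-involutive : ∀ m (i : Fin (suc k)) → subMod m (subMod m i) ≡ i
  subMod-involutive m i = toℕ-injective (begin
    toℕ (subMod m (subMod m i)) ≡⟨ toℕ-subMod m (subMod m i) ⟩
    m ⊖ toℕ (subMod m i)        ≡⟨ cong (m ⊖_) (toℕ-subMod m i) ⟩
    m ⊖ (m ⊖ toℕ i)             ≡⟨ ⊖-involutive m (toℕ<n i) ⟩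
    toℕ i                       ∎)
    where open ≡-Reasoning

  ·wx^-involutive : ∀ a m → a ·wx^ m ·wx^ m ≡ a
  ·wx^-involutive (inj₁ i) m = cong inj₁ (subMod-involutive m i)
  ·wx^-involutive (inj₂ i) m = cong inj₂ (subMod-involutive m i)

  splitAt-mulWX : ∀ a m → splitAt (suc k) (mulWX (suc k) a m) ≡ splitAt (suc k) a ·wx^ m
  splitAt-mulWX a m with splitAt (suc k) a
  ... | inj₁ i = splitAt-join (suc k) (suc k) (inj₂ _)
  ... | inj₂ i = splitAt-join (suc k) (suc k) (inj₁ _)

  splitAt-injective : ∀ {a b : Fin (suc k + suc k)} → splitAt (suc k) a ≡ splitAt (suc k) b → a ≡ b
  splitAt-injective {a} {b} eq = begin
    a                                 ≡⟨ join-splitAt (suc k) (suc k) a ⟨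
    join (suc k) (suc k) (splitAt (suc k) a) ≡⟨ cong (join (suc k) (suc k)) eq ⟩
    join (suc k) (suc k) (splitAt (suc k) b) ≡⟨ join-splitAt (suc k) (suc k) b ⟩
    b                                 ∎
    where open ≡-Reasoning

  mulWX-involutive : ∀ a m → mulWX (suc k) (mulWX (suc k) a m) m ≡ a
  mulWX-involutive a m = splitAt-injective (begin
    splitAt (suc k) (mulWX (suc k) (mulWX (suc k) a m) m) ≡⟨ splitAt-mulWX (mulWX (suc k) a m) m ⟩
    splitAt (suc k) (mulWX (suc k) a m) ·wx^ m            ≡⟨ cong (_·wx^ m) (splitAt-mulWX a m) ⟩
    splitAt (suc k) a ·wx^ m ·wx^ m                       ≡⟨ ·wx^-involutive (splitAt (suc k) a) m ⟩
    splitAt (suc k) a                                     ∎)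
    where open ≡-Reasoning

  infixl 6 _+ᶠ_
  _+ᶠ_ : Fin (suc k) → Fin (suc k) → Fin (suc k)
  i +ᶠ j = (toℕ i + toℕ j) mod suc k

  toℕ-+ᶠ : ∀ i j → toℕ (i +ᶠ j) ≡ (toℕ i + toℕ j) % suc k
  toℕ-+ᶠ i j = toℕ-fromℕ< _

  subMod-+ᶠ : ∀ m i c → subMod m i +ᶠ c ≡ subMod m (subMod (toℕ i) c)
  subMod-+ᶠ m i c = toℕ-injective (begin
    toℕ (subMod m i +ᶠ c)              ≡⟨ toℕ-+ᶠ (subMod m i) c ⟩
    (toℕ (subMod m i) + toℕ c) % suc k ≡⟨ cong (λ x → (x + toℕ c) % suc k) (toℕ-subMod m i) ⟩
    (m ⊖ toℕ i + toℕ c) % suc k        ≡⟨ [m⊖i+k]%n≡m⊖[i⊖k] m (<⇒≤ (toℕ<n i)) (<⇒≤ (toℕ<n c)) ⟩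
    m ⊖ (toℕ i ⊖ toℕ c)                ≡⟨ cong (m ⊖_) (toℕ-subMod (toℕ i) c) ⟨
    m ⊖ toℕ (subMod (toℕ i) c)         ≡⟨ toℕ-subMod m (subMod (toℕ i) c) ⟨
    toℕ (subMod m (subMod (toℕ i) c))  ∎)
    where open ≡-Reasoning

  subMod-subMod : ∀ m i c → subMod (toℕ (subMod m i)) c ≡ subMod m (i +ᶠ c)
  subMod-subMod m i c = toℕ-injective (begin
    toℕ (subMod (toℕ (subMod m i)) c) ≡⟨ toℕ-subMod (toℕ (subMod m i)) c ⟩
    toℕ (subMod m i) ⊖ toℕ c          ≡⟨ cong (_⊖ toℕ c) (toℕ-subMod m i) ⟩
    m ⊖ toℕ i ⊖ toℕ c                 ≡⟨ [m⊖i]⊖k≡m⊖[i+k]%n m (<⇒≤ (toℕ<n i)) (<⇒≤ (toℕ<n c)) ⟩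
    m ⊖ ((toℕ i + toℕ c) % suc k)     ≡⟨ cong (m ⊖_) (toℕ-+ᶠ i c) ⟨
    m ⊖ toℕ (i +ᶠ c)                  ≡⟨ toℕ-subMod m (i +ᶠ c) ⟨
    toℕ (subMod m (i +ᶠ c))           ∎)
    where open ≡-Reasoning

  -- u ⁻¹· v = u⁻¹ v, using (x^c)⁻¹ = x^(-c) and (w x^c)⁻¹ = w x^c.
  infixl 7 _⁻¹·_
  _⁻¹·_ : Element → Element → Element
  inj₁ c ⁻¹· inj₁ i = inj₁ (subMod (toℕ i) c)
  inj₁ c ⁻¹· inj₂ i = inj₂ (i +ᶠ c)
  inj₂ c ⁻¹· inj₁ i = inj₂ (i +ᶠ c)
  inj₂ c ⁻¹· inj₂ i = inj₁ (subMod (toℕ i) c)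

  ⁻¹·-·wx^ : ∀ u a m → u ⁻¹· (a ·wx^ m) ≡ u ⁻¹· a ·wx^ m
  ⁻¹·-·wx^ (inj₁ c) (inj₁ i) m = cong inj₂ (subMod-+ᶠ m i c)
  ⁻¹·-·wx^ (inj₁ c) (inj₂ i) m = cong inj₁ (subMod-subMod m i c)
  ⁻¹·-·wx^ (inj₂ c) (inj₁ i) m = cong inj₁ (subMod-subMod m i c)
  ⁻¹·-·wx^ (inj₂ c) (inj₂ i) m = cong inj₂ (subMod-+ᶠ m i c)

  subMod≡zero : ∀ i c → subMod (toℕ i) c ≡ zero → i ≡ c
  subMod≡zero i c eq =
    toℕ-injective (m⊖i≡0⇒m≡i (toℕ<n i) (toℕ<n c) (trans (sym (toℕ-subMod (toℕ i) c)) (cong toℕ eq)))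

  ⁻¹·≡e : ∀ u a → u ⁻¹· a ≡ e → a ≡ u
  ⁻¹·≡e (inj₁ c) (inj₁ i) eq = cong inj₁ (subMod≡zero i c (inj₁-injective eq))
  ⁻¹·≡e (inj₂ c) (inj₂ i) eq = cong inj₂ (subMod≡zero i c (inj₁-injective eq))

  ·wx^-cancelˡ : ∀ a {m₁ m₂} → m₁ < suc k → m₂ < suc k → a ·wx^ m₁ ≡ a ·wx^ m₂ → m₁ ≡ m₂
  ·wx^-cancelˡ a {m₁} {m₂} m₁<n m₂<n eq = ⊖-cancelʳ m₁<n m₂<n (<⇒≤ (exponent<n a)) (begin
    m₁ ⊖ exponent a       ≡⟨ exponent-·wx^ a m₁ ⟨
    exponent (a ·wx^ m₁)  ≡⟨ cong exponent eq ⟩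
    exponent (a ·wx^ m₂)  ≡⟨ exponent-·wx^ a m₂ ⟩
    m₂ ⊖ exponent a       ∎)
    where open ≡-Reasoning

-- Broadcasting in the Cayley graph

module StandardSchedule (k d : ℕ) (n≡ : suc k ≡ 2 ^ suc d ∸ 1) where

  open ModularSubtraction (suc k)
  open Dihedral k

  -- Round Δ falls back to generator 0, which is w = w x^0.
  roundGen : ℕ → Fin (suc d)
  roundGen q with q <? suc d
  ... | yes q<Δ = fromℕ< q<Δ
  ... | no _    = zero

  roundExp : ℕ → ℕ
  roundExp q = genExp (toℕ (roundGen q))

  roundExp-< : ∀ {q} → q < suc d → roundExp q ≡ 2 ^ q ∸ 1
  roundExp-< {q} q<Δ with q <? suc d
  ... | yes q<Δ′ = cong genExp (toℕ-fromℕ< q<Δ′)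
  ... | no q≮Δ   = ⊥-elim (q≮Δ q<Δ)

  roundExp-≮ : ∀ {q} → ¬ q < suc d → roundExp q ≡ 0
  roundExp-≮ {q} q≮Δ with q <? suc d
  ... | yes q<Δ = ⊥-elim (q≮Δ q<Δ)
  ... | no _    = refl

  genExp<n : ∀ {q} → q < suc d → genExp q < suc k
  genExp<n {q} q<Δ = subst (genExp q <_) (sym n≡) (∸-monoˡ-< (^-monoʳ-< 2 (s≤s (s≤s z≤n)) q<Δ) (m^n>0 2 q))

  roundExp⊖ : ∀ {q i} → q ≤ suc d → i < suc k → i < 2 ^ q → q < suc d ⊎ 0 < i →
              roundExp q ⊖ i ≡ 2 ^ q ∸ 1 ∸ i
  roundExp⊖ {q} {i} q≤Δ i<n i<2^q last with m≤n⇒m<n∨m≡n q≤Δ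
  ... | inj₁ q<Δ = begin
    roundExp q ⊖ i              ≡⟨ cong (_⊖ i) (roundExp-< q<Δ) ⟩
    (genExp q + suc k ∸ i) % suc k ≡⟨ cong (_% suc k) (+-∸-comm (suc k) (<⇒≤∸1 i<2^q)) ⟩
    (genExp q ∸ i + suc k) % suc k ≡⟨ [m+n]%n≡m%n (genExp q ∸ i) (suc k) ⟩
    (genExp q ∸ i) % suc k      ≡⟨ m<n⇒m%n≡m (≤-<-trans (m∸n≤m (genExp q) i) (genExp<n q<Δ)) ⟩
    genExp q ∸ i                ∎
    where
    open ≡-Reasoning
    <⇒≤∸1 : ∀ {i m} → i < m → i ≤ m ∸ 1
    <⇒≤∸1 {m = suc m} (s≤s i≤m) = i≤m
  ... | inj₂ refl with last
  ...   | inj₁ Δ<Δ = ⊥-elim (<-irrefl refl Δ<Δ)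
  ...   | inj₂ 0<i = begin
    roundExp (suc d) ⊖ i        ≡⟨ cong (_⊖ i) (roundExp-≮ (<-irrefl refl)) ⟩
    (suc k ∸ i) % suc k         ≡⟨ m<n⇒m%n≡m (∸-monoʳ-< 0<i (<⇒≤ i<n)) ⟩
    suc k ∸ i                   ≡⟨ cong (_∸ i) n≡ ⟩
    2 ^ suc d ∸ 1 ∸ i           ∎
    where open ≡-Reasoning

  Informed : ℕ → Element → Set
  Informed zero    a = a ≡ e
  Informed (suc q) a = exponent a < 2 ^ q

  informed? : ∀ q a → Dec (Informed q a)
  informed? zero    a = Sum.≡-dec _≟_ _≟_ a e
  informed? (suc q) a = exponent a <? 2 ^ q

  -- In the last round the generator is w, which swaps e and w; both are informed already,
  -- so they stay silent.
  Calls : ℕ → Element → Set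
  Calls q a = q ≤ suc d × Informed q a × (q < suc d ⊎ 0 < exponent a)

  calls? : ∀ q a → Dec (Calls q a)
  calls? q a = q ≤? suc d ×-dec informed? q a ×-dec (q <? suc d ⊎-dec 0 <? exponent a)

  partner-exponent : ∀ {q} a → q ≤ suc d → exponent a < 2 ^ q → (q < suc d ⊎ 0 < exponent a) →
                     exponent (a ·wx^ roundExp q) ≡ 2 ^ q ∸ 1 ∸ exponent a
  partner-exponent {q} a q≤Δ a<2^q last =
    trans (exponent-·wx^ a (roundExp q)) (roundExp⊖ q≤Δ (exponent<n a) a<2^q last)

  calls⇒partner-uninformed : ∀ q a → Calls q a → ¬ Informed q (a ·wx^ roundExp q)
  calls⇒partner-uninformed zero    .e      (_ , refl , _) ()
  calls⇒partner-uninformed (suc q) a (q<Δ , a<2^q , last) partner<2^q =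
    <⇒≱ partner<2^q (subst (2 ^ q ≤_) (sym (partner-exponent a q<Δ (≤-trans a<2^q (m≤m+n _ _)) last))
                                       (i<P⇒P≤2*P∸1∸i a<2^q))

  newly-informed⇒partner-calls : ∀ q a → q ≤ suc d → Informed (suc q) a → ¬ Informed q a →
                                 Calls q (a ·wx^ roundExp q)
  newly-informed⇒partner-calls zero (inj₁ i) _ i<1 a≢e = ⊥-elim (a≢e (cong inj₁ (toℕ-injective (n<1⇒n≡0 i<1))))
  newly-informed⇒partner-calls zero (inj₂ i) _ i<1 _   = z≤n , cong inj₁ (toℕ-injective partner≡0) , inj₁ (s≤s z≤n)
    where
    partner≡0 : toℕ (subMod (roundExp 0) i) ≡ 0
    partner≡0 = begin
      toℕ (subMod (roundExp 0) i) ≡⟨ toℕ-subMod (roundExp 0) i ⟩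
      roundExp 0 ⊖ toℕ i          ≡⟨ roundExp⊖ z≤n (toℕ<n i) i<1 (inj₁ (s≤s z≤n)) ⟩
      0 ∸ toℕ i                   ≡⟨ 0∸n≡0 (toℕ i) ⟩
      0                           ∎
      where open ≡-Reasoning
  newly-informed⇒partner-calls (suc q) a q<Δ a<2^[1+q] a≮2^q =
    q<Δ , subst (_< 2 ^ q) (sym partner≡) (P≤i<2*P⇒2*P∸1∸i<P 2^q≤a a<2^[1+q]) , partner-last
    where
    2^q≤a : 2 ^ q ≤ exponent a
    2^q≤a = ≮⇒≥ a≮2^q
    a-last : suc q < suc d ⊎ 0 < exponent a
    a-last = inj₂ (≤-trans (m^n>0 2 q) 2^q≤a)
    partner≡ : exponent (a ·wx^ roundExp (suc q)) ≡ 2 ^ suc q ∸ 1 ∸ exponent a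
    partner≡ = partner-exponent a q<Δ a<2^[1+q] a-last
    partner-last : suc q < suc d ⊎ 0 < exponent (a ·wx^ roundExp (suc q))
    partner-last with m≤n⇒m<n∨m≡n q<Δ
    ... | inj₁ q<d  = inj₁ q<d
    ... | inj₂ refl = inj₂ (subst (0 <_) (sym (trans partner≡ (cong (_∸ exponent a) (sym n≡))))
                                         (m<n⇒0<n∸m (exponent<n a)))

  informed-last : ∀ a → Informed (suc (suc d)) a
  informed-last a = <-≤-trans (exponent<n a) (subst (_≤ 2 ^ suc d) (sym n≡) (m∸n≤m (2 ^ suc d) 1))

-- CayleyGraph Δ is Cayley (nΔ Δ) Δ; keeping the order abstract lets it be matched as suc k.
Cayley : ℕ → ℕ → Graph
Cayley n Δ = record
  { order = n + n
  ; adj   = λ a b → ⌊ any? (λ (j : Fin Δ) → mulWX n a (genExp (toℕ j)) ≟ b) ⌋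
  }

module CayleyBroadcast (k d : ℕ) (n≡ : suc k ≡ 2 ^ suc d ∸ 1) where

  open Dihedral k
  open StandardSchedule k d n≡

  G : Graph
  G = Cayley (suc k) (suc d)

  Vertex : Set
  Vertex = Fin (suc k + suc k)

  neighbour : Vertex → Fin (suc d) → Vertex
  neighbour a j = mulWX (suc k) a (genExp (toℕ j))

  -- The schedule from u is the translate by u of the schedule from e.
  relative : Vertex → Vertex → Element
  relative u a = splitAt (suc k) u ⁻¹· splitAt (suc k) a

  relative-mulWX : ∀ u a m → relative u (mulWX (suc k) a m) ≡ relative u a ·wx^ m
  relative-mulWX u a m =
    trans (cong (splitAt (suc k) u ⁻¹·_) (splitAt-mulWX a m)) (⁻¹·-·wx^ _ (splitAt (suc k) a) m)

  relative≡e : ∀ u a → relative u a ≡ e → a ≡ u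
  relative≡e u a eq = splitAt-injective (⁻¹·≡e (splitAt (suc k) u) (splitAt (suc k) a) eq)

  mulWX-injective : ∀ {a b} m → mulWX (suc k) a m ≡ mulWX (suc k) b m → a ≡ b
  mulWX-injective {a} {b} m eq =
    trans (sym (mulWX-involutive a m)) (trans (cong (λ x → mulWX (suc k) x m) eq) (mulWX-involutive b m))

  adjacent-round : ∀ a q → Adj G a (mulWX (suc k) a (roundExp q))
  adjacent-round a q = fromWitness (roundGen q , refl)

  schedule : Vertex → Schedule G
  schedule u q a with calls? q (relative u a)
  ... | yes _ = just (mulWX (suc k) a (roundExp q))
  ... | no _  = nothing

  schedule-calls : ∀ u q a → Calls q (relative u a) → schedule u q a ≡ just (mulWX (suc k) a (roundExp q))
  schedule-calls u q a calls with calls? q (relative u a)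
  ... | yes _      = refl
  ... | no ¬calls = ⊥-elim (¬calls calls)

  schedule-silent : ∀ u q a → ¬ Calls q (relative u a) → schedule u q a ≡ nothing
  schedule-silent u q a ¬calls with calls? q (relative u a)
  ... | yes calls = ⊥-elim (¬calls calls)
  ... | no _      = refl

  schedule-just : ∀ u q a {b} → schedule u q a ≡ just b → Calls q (relative u a) × mulWX (suc k) a (roundExp q) ≡ b
  schedule-just u q a eq with calls? q (relative u a) | eq
  ... | yes calls | refl = calls , refl

  module _ (u : Vertex) where

    informed⇒known : ∀ {q} → q ≤ suc (suc d) → ∀ a → Informed q (relative u a) → Known G u (schedule u) q a
    informed⇒known {zero}  _     a a∈ = relative≡e u a a∈
    informed⇒known {suc q} q<Δ+2 a a∈ with informed? q (relative u a)
    ... | yes a∈′ = inj₁ (informed⇒known (<⇒≤ q<Δ+2) a a∈′)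
    ... | no a∉   = inj₂ (b , informed⇒known (<⇒≤ q<Δ+2) b (proj₁ (proj₂ b-calls)) ,
                             trans (schedule-calls u q b b-calls) (cong just (mulWX-involutive a m)))
      where
      m = roundExp q
      b = mulWX (suc k) a m
      b-calls : Calls q (relative u b)
      b-calls = subst (Calls q) (sym (relative-mulWX u a m))
                      (newly-informed⇒partner-calls q (relative u a) (s≤s⁻¹ q<Δ+2) a∈ a∉)

    partner-uninformed : ∀ {q a} → Calls q (relative u a) → ¬ Informed q (relative u (mulWX (suc k) a (roundExp q)))
    partner-uninformed {q} {a} calls partner∈ =
      calls⇒partner-uninformed q (relative u a) calls (subst (Informed q) (relative-mulWX u a (roundExp q)) partner∈)

    valid : ∀ t → ValidSchedule G u (schedule u) t
    valid t i _ v w σv with schedule-just u i v σv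
    ... | calls , refl = v∈ , adjacent-round v i , w-silent , unique-caller , v-not-called
      where
      m = roundExp i
      v∈ : Known G u (schedule u) i v
      v∈ = informed⇒known (m≤n⇒m≤1+n (proj₁ calls)) v (proj₁ (proj₂ calls))
      w-silent : schedule u i (mulWX (suc k) v m) ≡ nothing
      w-silent = schedule-silent u i _ (partner-uninformed {a = v} calls ∘ proj₁ ∘ proj₂)
      unique-caller : ∀ v′ → schedule u i v′ ≡ just (mulWX (suc k) v m) → v′ ≡ v
      unique-caller v′ σv′ = mulWX-injective m (proj₂ (schedule-just u i v′ σv′))
      v-not-called : ∀ v′ → schedule u i v′ ≡ just v → ⊥
      v-not-called v′ σv′ with schedule-just u i v′ σv′
      ... | calls′ , refl = partner-uninformed {a = v′} calls′ (proj₁ (proj₂ calls))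

    broadcastFrom : BroadcastFromWithin G u (suc d + 1)
    broadcastFrom = schedule u , valid _ , λ v →
      subst (λ t → Known G u (schedule u) t v) (cong suc (+-comm 1 d))
            (informed⇒known ≤-refl v (informed-last (relative u v)))

  isGraph : IsGraph G
  isGraph = adj-sym , adj-irrefl , connected
    where
    adjacent? : ∀ a b → Dec (∃ λ j → neighbour a j ≡ b)
    adjacent? a b = any? (λ j → neighbour a j ≟ b)
    reflect : ∀ a b → ∃ (λ j → neighbour a j ≡ b) → ∃ (λ j → neighbour b j ≡ a)
    reflect a b (j , eq) = j , trans (cong (λ x → mulWX (suc k) x (genExp (toℕ j))) (sym eq)) (mulWX-involutive a _)
    adj-sym : ∀ a b → adj G a b ≡ adj G b a
    adj-sym a b = trans (isYes≗does (adjacent? a b))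
                        (trans (does-⇔ (mk⇔ (reflect a b) (reflect b a)) (adjacent? a b) (adjacent? b a))
                               (sym (isYes≗does (adjacent? b a))))
    adj-irrefl : ∀ a → adj G a a ≡ false
    adj-irrefl a = trans (isYes≗does (adjacent? a a)) (dec-false (adjacent? a a) λ (j , eq) →
      ·wx^-≢ (splitAt (suc k) a) _ (trans (sym (splitAt-mulWX a _)) (cong (splitAt (suc k)) eq)))
    connected : ∀ u v → Reach G u v
    connected u v = known⇒reach G (valid u (suc d + 1)) ≤-refl (proj₂ (proj₂ (broadcastFrom u)) v)

  degree≡Δ : ∀ a → degree G a ≡ suc d
  degree≡Δ a = trans (length-filterᵇ-allFin _ (adj G a)) (imageSize-injective (neighbour a) neighbours-distinct)
    where
    neighbours-distinct : ∀ {i j} → neighbour a i ≡ neighbour a j → i ≡ j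
    neighbours-distinct {i} {j} eq = toℕ-injective (genExp-injective (·wx^-cancelˡ (splitAt (suc k) a)
      (genExp<n (toℕ<n i)) (genExp<n (toℕ<n j))
      (trans (sym (splitAt-mulWX a _)) (trans (cong (splitAt (suc k)) eq) (splitAt-mulWX a _)))))

  maxDegree : MaxDegree G (suc d)
  maxDegree = ≤-reflexive ∘ degree≡Δ , zero , degree≡Δ zero

Cayley-optimal : ∀ k d → suc k ≡ 2 ^ suc d ∸ 1 →
                 OptimalBroadcastNetwork (Cayley (suc k) (suc d)) (suc d) (suc d + 1)
Cayley-optimal k d n≡ = isGraph , maxDegree , broadcastFrom , largest
  where
  open CayleyBroadcast k d n≡
  largest : ∀ H → IsGraph H → MaxDegree H (suc d) → BroadcastTimeAtMost H (suc d + 1) → order H ≤ suc k + suc k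
  largest H (symm , _) (degree≤ , _) broadcast = begin
    order H                                     ≤⟨ broadcastTime⇒order≤capacity H d symm degree≤ broadcast ⟩
    capacity d (suc d) (suc d + 1)              ≡⟨ cong (capacity d (suc d) ∘′ suc) (+-comm d 1) ⟩
    capacity d d (suc d) + capacity d d (suc d) ≡⟨ cong (λ x → x + x) (trans (capacity-diagonal d) (sym n≡)) ⟩
    suc k + suc k                               ∎
    where open ≤-Reasoning

nΔ≡suc : ∀ d → ∃ λ k → suc k ≡ nΔ (suc d)
nΔ≡suc d = 2 ^ suc d ∸ 2 , sym (+-∸-assoc 1 (^-monoʳ-≤ 2 {1} {suc d} (s≤s z≤n)))

order-CayleyGraph : ∀ Δ → order (CayleyGraph Δ) ≡ 2 ^ (Δ + 1) ∸ 2
order-CayleyGraph Δ = begin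
  (2 ^ Δ ∸ 1) + (2 ^ Δ ∸ 1) ≡⟨ [m∸1]+[m∸1]≡m+m∸2 (m^n>0 2 Δ) ⟩
  2 ^ Δ + 2 ^ Δ ∸ 2         ≡⟨ cong (λ x → 2 ^ Δ + x ∸ 2) (+-identityʳ (2 ^ Δ)) ⟨
  2 ^ suc Δ ∸ 2             ≡⟨ cong (λ x → 2 ^ x ∸ 2) (+-comm 1 Δ) ⟩
  2 ^ (Δ + 1) ∸ 2           ∎
  where
  open ≡-Reasoning
  [m∸1]+[m∸1]≡m+m∸2 : ∀ {m} → 1 ≤ m → (m ∸ 1) + (m ∸ 1) ≡ m + m ∸ 2
  [m∸1]+[m∸1]≡m+m∸2 {suc p} _ = sym (cong (_∸ 1) (+-suc p p))

theorem1 : (Δ : ℕ) → 1 ≤ Δ →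
    OptimalBroadcastNetwork (CayleyGraph Δ) Δ (Δ + 1) ×
    order (CayleyGraph Δ) ≡ 2 ^ (Δ + 1) ∸ 2
theorem1 (suc d) _ with nΔ≡suc d
... | k , n≡ = subst (λ n → OptimalBroadcastNetwork (Cayley n (suc d)) (suc d) (suc d + 1)) n≡ (Cayley-optimal k d n≡)
             , order-CayleyGraph (suc d)
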